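{- For every $n\ge 3$, $$\tilde\chi(\mathcal P_n)=\begin{cases}0 & \text{if } n \text{ is odd},\\ \frac{2(-1)^{n/2}}{n}\binom{n-2}{\frac12(n-2)} & \text{if } n \text{ is even}.\end{cases}$$
   Context: $[n]=\{1,\dots,n\}$; $\mathfrak S_n$ is the set of permutations of $[n]$ in one-line notation. The circular peak set of $\sigma\in\mathfrak S_n$ is $CP(\sigma)=\{\sigma(i)\mid 2\le i\le n-1,\ \sigma(i-1)<\sigma(i)>\sigma(i+1)\}$; for $S\subseteq[n]$, $CP_n(S)=\{\sigma\in\mathfrak S_n\mid CP(\sigma)=S\}$, and $\mathcal P_n=\{S\subseteq[n]\mid CP_n(S)\neq\emptyset\}$. For $i\ge-1$, $p_{n,i}$ is the number of $S\in\mathcal P_n$ with $|S|=i+1$. The reduced Euler characteristic of $\mathcal P_n$ is $\tilde\chi(\mathcal P_n)=\sum_{i=0}^{\lfloor\frac{n-1}{2}\rfloor}(-1)^{i-1}p_{n,i-1}$. -}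

module Defs where

open import Data.Bool using (Bool; true; false; if_then_else_)
open import Data.Nat as ℕ using (ℕ; zero; suc; _∸_; _/_)
open import Data.Fin using (Fin; _<?_)
open import Data.Fin.Properties using (all?) renaming (_≟_ to _≟ᶠ_)
open import Data.Fin.Subset using (Subset; ∣_∣)
open import Data.Vec as Vec using (Vec; []; _∷_; lookup; toList; tabulate)
open import Data.Vec.Properties using (≡-dec)
open import Data.List as List using (List; []; _∷_; length; filter; upTo; allFin; concatMap; map; sum)
open import Data.List.Relation.Unary.Any using (Any; any?)
open import Data.Integer as ℤ using (ℤ; +_; -_)
open import Relation.Nullary using (Dec; does)
open import Relation.Nullary.Decidable using (_→-dec_; ⌊_⌋)
open import Relation.Binary.PropositionalEquality using (_≡_)
import Data.Bool.Properties as BoolP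

words : ∀ {A : Set} → List A → (k : ℕ) → List (Vec A k)
words xs zero    = [] ∷ []
words xs (suc k) = concatMap (λ x → map (x ∷_) (words xs k)) xs

-- A permutation of [n] in one-line notation: a word σ(1)…σ(n) over [n]
-- (encoded as Fin n) with pairwise distinct letters (i.e. σ injective, hence bijective).
IsPerm : ∀ {n} → Vec (Fin n) n → Set
IsPerm {n} σ = ∀ i j → lookup σ i ≡ lookup σ j → i ≡ j

isPerm? : ∀ {n} (σ : Vec (Fin n) n) → Dec (IsPerm σ)
isPerm? σ = all? (λ i → all? (λ j → (lookup σ i ≟ᶠ lookup σ j) →-dec (i ≟ᶠ j)))

𝔖 : (n : ℕ) → List (Vec (Fin n) n)
𝔖 n = filter isPerm? (words (allFin n) n)

peakValues : ∀ {n} → List (Fin n) → List (Fin n)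
peakValues (a ∷ b ∷ c ∷ rest) =
  (if ⌊ a <? b ⌋ then (if ⌊ c <? b ⌋ then b ∷ [] else []) else [])
  List.++ peakValues (b ∷ c ∷ rest)
peakValues _ = []

CP : ∀ {n} → Vec (Fin n) n → Subset n
CP σ = tabulate (λ v → ⌊ any? (v ≟ᶠ_) (peakValues (toList σ)) ⌋)

_∈𝒫_ : ∀ {n} → Subset n → (n' : ℕ) → Set
_∈𝒫_ {n} S _ = Any (λ σ → CP σ ≡ S) (𝔖 n)

∈𝒫? : ∀ {n} (S : Subset n) → Dec (S ∈𝒫 n)
∈𝒫? {n} S = any? (λ σ → ≡-dec BoolP._≟_ (CP σ) S) (𝔖 n)

allSubsets : (n : ℕ) → List (Subset n)
allSubsets n = words (true ∷ false ∷ []) n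

-- 𝒫ₙ as a list (without repetitions, since allSubsets has none).
𝒫 : (n : ℕ) → List (Subset n)
𝒫 n = filter ∈𝒫? (allSubsets n)

-- cardP n k = number of S ∈ 𝒫ₙ with |S| = k.  Thus p_{n,i} = cardP n (i+1),
-- and in particular p_{n,i-1} = cardP n i.
cardP : ℕ → ℕ → ℕ
cardP n k = length (filter (λ S → ∣ S ∣ ℕ.≟ k) (𝒫 n))

negOnePow : ℕ → ℤ
negOnePow zero    = + 1
negOnePow (suc k) = - negOnePow k

-- χ̃(𝒫ₙ) = Σ_{i=0}^{⌊(n-1)/2⌋} (-1)^{i-1} p_{n,i-1},  with (-1)^{i-1} = -(-1)^i.
χ̃ : ℕ → ℤ
χ̃ n = List.foldr ℤ._+_ (+ 0)
        (map (λ i → (- negOnePow i) ℤ.* + cardP n i) (upTo (suc ((n ∸ 1) / 2))))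

-- A set S ⊆ [n] is a peak set iff, listing 1, …, n in increasing order, the (j+1)-st smallest
-- element of S has at least j + 2 non-elements of S below it.  Necessity: among the values up to
-- a peak, the peaks are pairwise non-adjacent in σ and have smaller neighbours, so j + 1 of them
-- need 2j + 3 values.  Sufficiency: alternate the increasing list of non-peaks with the
-- increasing list of peaks.  Reading this condition as a ballot sequence, the number a(n, k) of
-- k-element peak sets satisfies a(n+1, k+1) = a(n, k+1) + a(n, k) when 2k + 2 ≤ n and vanishes
-- for n ≤ 2k, whence a(N+1, k+1) = C(N, k+1) − C(N, k) and (m+1)·a(2m+1, m) = C(2m, m).  The
-- same recurrence telescopes the alternating sum: χ̃(𝒫_{2m+3}) = ±a(2m+2, m+1) = 0 and
-- χ̃(𝒫_{2m+2}) = −(−1)^m a(2m+1, m), a signed Catalan number.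
module Submission where

open import Defs

module PeakSetCharacterisation where

  open import Data.Bool using (Bool; true; false; T; not)
  open import Data.Empty using (⊥; ⊥-elim)
  open import Data.Fin as Fin using (Fin; toℕ; _<?_) renaming (_<_ to _<ᶠ_)
  open import Data.Fin.Properties using (toℕ-injective; <-asym) renaming (_≟_ to _≟ᶠ_)
  open import Data.List
    using (List; []; _∷_; _++_; _∷ʳ_; length; map; filter; filterᵇ; foldl; take; allFin; upTo)
  import Data.List as List
  open import Data.List.Properties
    using ( foldl-∷ʳ; filter-accept; filter-reject; filter-none; filter-≐; take-[]; take-map
          ; length-map; length-upTo; length-++; length-++-sucʳ; length-tabulate; map-tabulate; ∷ʳ-++ )
  open import Data.List.Membership.Propositional using (_∈_; find; lose)
  open import Data.List.Membership.Propositional.Properties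
    using ( ∈-filter⁺; ∈-filter⁻; ∈-allFin; ∈-∃++; ∈-++⁻; ∈-++⁺ˡ; ∈-++⁺ʳ; ∈-map⁺; ∈-map⁻; ∈-upTo⁺
          ; ∈-concatMap⁺ )
  open import Data.List.Relation.Binary.Disjoint.Propositional using (Disjoint)
  open import Data.List.Relation.Binary.Subset.Propositional using (_⊆_)
  open import Data.List.Relation.Unary.All as All using (All; []; _∷_)
  open import Data.List.Relation.Unary.All.Properties using (++⁺; ++⁻ˡ; ++⁻ʳ)
  open import Data.List.Relation.Unary.AllPairs as AllPairs using (AllPairs; []; _∷_)
  open import Data.List.Relation.Unary.AllPairs.Properties using (tabulate⁺-<)
  open import Data.List.Relation.Unary.Any using (here; there; any?)
  open import Data.List.Relation.Unary.Unique.Propositional using (Unique)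
  import Data.List.Relation.Unary.Unique.Propositional.Properties as Unique
  open import Data.Maybe using (Maybe; just; nothing; is-just)
  open import Data.Nat using (ℕ; zero; suc; _+_; _*_; _≤_; _<_; z≤n; s≤s)
  import Data.Nat as ℕ
  open import Data.Nat.Properties
    using ( +-suc; +-comm; +-identityʳ; *-suc; *-monoʳ-≤; ≤-trans; <-trans; <⇒≤; ≤-pred; ≤-reflexive
          ; module ≤-Reasoning )
  open import Data.Nat.Tactic.RingSolver using (solve-∀)
  open import Data.Product using (_,_; proj₂)
  open import Data.Sum using (_⊎_; inj₁; inj₂)
  open import Data.Vec using (Vec; toList; lookup)
  import Data.Vec as Vec
  open import Data.Vec.Properties
    using (lookup∘tabulate; tabulate∘lookup; tabulate-cong; toList-cast; toList∘fromList)
  open import Function using (_∘_)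
  open import Relation.Nullary using (¬_; Dec; yes; no; does; contradiction)
  open import Relation.Nullary.Decidable using (⌊_⌋; toWitness; fromWitness; T?)
  open import Relation.Unary using (Decidable)
  open import Relation.Binary.PropositionalEquality

  T-injective : ∀ {a b} → (T a → T b) → (T b → T a) → a ≡ b
  T-injective {false} {false} _ _ = refl
  T-injective {false} {true}  _ g = ⊥-elim (g _)
  T-injective {true}  {false} f _ = ⊥-elim (f _)
  T-injective {true}  {true}  _ _ = refl

  Unique-⊆⇒length-≤ : ∀ {A : Set} {xs ys : List A} → Unique xs → xs ⊆ ys → length xs ≤ length ys
  Unique-⊆⇒length-≤ {xs = []}     _               _     = z≤n
  Unique-⊆⇒length-≤ {xs = x ∷ xs} (x∉xs ∷ unique) xs⊆ys
    with ys₁ , ys₂ , refl ← ∈-∃++ (xs⊆ys (here refl)) = begin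
      suc (length xs)            ≤⟨ s≤s (Unique-⊆⇒length-≤ unique xs⊆ys₁++ys₂) ⟩
      suc (length (ys₁ ++ ys₂))  ≡⟨ length-++-sucʳ ys₁ x ys₂ ⟨
      length (ys₁ ++ x ∷ ys₂)    ∎
    where
    open ≤-Reasoning
    xs⊆ys₁++ys₂ : xs ⊆ ys₁ ++ ys₂
    xs⊆ys₁++ys₂ y∈xs with ∈-++⁻ ys₁ (xs⊆ys (there y∈xs))
    ... | inj₁ y∈ys₁          = ∈-++⁺ˡ y∈ys₁
    ... | inj₂ (here refl)    = contradiction refl (All.lookup x∉xs y∈xs)
    ... | inj₂ (there y∈ys₂)  = ∈-++⁺ʳ ys₁ y∈ys₂

  filter-map : ∀ {A B : Set} {P : B → Set} (P? : Decidable P) (f : A → B) xs →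
               filter P? (map f xs) ≡ map f (filter (P? ∘ f) xs)
  filter-map P? f []       = refl
  filter-map P? f (x ∷ xs) with does (P? (f x))
  ... | true  = cong (f x ∷_) (filter-map P? f xs)
  ... | false = filter-map P? f xs

  length-filterᵇ-partition : ∀ {A : Set} (f : A → Bool) xs →
                             length (filterᵇ (not ∘ f) xs) + length (filterᵇ f xs) ≡ length xs
  length-filterᵇ-partition f []       = refl
  length-filterᵇ-partition f (x ∷ xs) with f x
  ... | true  = trans (+-suc _ _) (cong suc (length-filterᵇ-partition f xs))
  ... | false = cong suc (length-filterᵇ-partition f xs)

  take-suc-length : ∀ {A : Set} (ys : List A) {b} zs → take (suc (length ys)) (ys ++ b ∷ zs) ≡ ys ∷ʳ b
  take-suc-length []       zs = refl
  take-suc-length (y ∷ ys) zs = cong (y ∷_) (take-suc-length ys zs)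

  All-++-remove : ∀ {A : Set} {P : A → Set} xs {y ys} → All P (xs ++ y ∷ ys) → All P (xs ++ ys)
  All-++-remove xs all = ++⁺ (++⁻ˡ xs all) (All.tail (++⁻ʳ xs all))

  AllPairs-++-remove : ∀ {A : Set} {R : A → A → Set} xs {y ys} →
                       AllPairs R (xs ++ y ∷ ys) → AllPairs R (xs ++ ys)
  AllPairs-++-remove []       (_ ∷ rest)  = rest
  AllPairs-++-remove (x ∷ xs) (x~ ∷ rest) = All-++-remove xs x~ ∷ AllPairs-++-remove xs rest

  filter-below-allFin : ∀ n m → filter (λ (u : Fin n) → toℕ u ℕ.<? m) (allFin n) ≡ take m (allFin n)
  filter-below-allFin zero    m       = sym (take-[] m)
  filter-below-allFin (suc n) zero    = filter-none (λ u → toℕ u ℕ.<? 0) (All.universal (λ _ ()) (allFin (suc n)))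
  filter-below-allFin (suc n) (suc m) = cong (Fin.zero ∷_) (begin
    filter below (List.tabulate Fin.suc)
      ≡⟨ cong (filter below) (map-tabulate (λ i → i) Fin.suc) ⟨
    filter below (map Fin.suc (allFin n))
      ≡⟨ filter-map below Fin.suc (allFin n) ⟩
    map Fin.suc (filter (below ∘ Fin.suc) (allFin n))
      ≡⟨ cong (map Fin.suc) (filter-≐ _ _ (≤-pred , s≤s) (allFin n)) ⟩
    map Fin.suc (filter (λ u → toℕ u ℕ.<? m) (allFin n))
      ≡⟨ cong (map Fin.suc) (filter-below-allFin n m) ⟩
    map Fin.suc (take m (allFin n))
      ≡⟨ take-map m (allFin n) ⟨
    take m (map Fin.suc (allFin n))
      ≡⟨ cong (take m) (map-tabulate (λ i → i) Fin.suc) ⟩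
    take m (List.tabulate Fin.suc)
      ∎)
    where
    open ≡-Reasoning
    below : ∀ (u : Fin (suc n)) → Dec (toℕ u < suc m)
    below u = toℕ u ℕ.<? suc m

  toList≡tabulate-lookup : ∀ {A : Set} {n} (v : Vec A n) → toList v ≡ List.tabulate (lookup v)
  toList≡tabulate-lookup Vec.[]       = refl
  toList≡tabulate-lookup (x Vec.∷ v) = cong (x ∷_) (toList≡tabulate-lookup v)

  map-lookup-allFin : ∀ {A : Set} {n} (v : Vec A n) → map (lookup v) (allFin n) ≡ toList v
  map-lookup-allFin v = trans (map-tabulate (λ i → i) (lookup v)) (sym (toList≡tabulate-lookup v))

  lookup∈toList : ∀ {A : Set} {m} (v : Vec A m) i → lookup v i ∈ toList v
  lookup∈toList (x Vec.∷ v) Fin.zero    = here refl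
  lookup∈toList (x Vec.∷ v) (Fin.suc i) = there (lookup∈toList v i)

  Unique-toList⇒lookup-injective : ∀ {A : Set} {m} (v : Vec A m) → Unique (toList v) →
                                   ∀ i j → lookup v i ≡ lookup v j → i ≡ j
  Unique-toList⇒lookup-injective (x Vec.∷ v) (x∉ ∷ v!) Fin.zero    Fin.zero    _  = refl
  Unique-toList⇒lookup-injective (x Vec.∷ v) (x∉ ∷ v!) Fin.zero    (Fin.suc j) eq =
    contradiction eq (All.lookup x∉ (lookup∈toList v j))
  Unique-toList⇒lookup-injective (x Vec.∷ v) (x∉ ∷ v!) (Fin.suc i) Fin.zero    eq =
    contradiction (sym eq) (All.lookup x∉ (lookup∈toList v i))
  Unique-toList⇒lookup-injective (x Vec.∷ v) (x∉ ∷ v!) (Fin.suc i) (Fin.suc j) eq =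
    cong Fin.suc (Unique-toList⇒lookup-injective v v! i j eq)

  ∈-words : ∀ {A : Set} {xs : List A} → (∀ x → x ∈ xs) → ∀ {k} (v : Vec A k) → v ∈ words xs k
  ∈-words every Vec.[]       = here refl
  ∈-words every (x Vec.∷ v) = ∈-concatMap⁺ _ (lose (every x) (∈-map⁺ (x Vec.∷_) (∈-words every v)))

  interleave : ∀ {A : Set} → List A → List A → List A
  interleave N       []      = N
  interleave []      (p ∷ P) = p ∷ P
  interleave (x ∷ N) (p ∷ P) = x ∷ p ∷ interleave N P

  ∈-interleave⁻ : ∀ {A : Set} {z : A} N P → z ∈ interleave N P → z ∈ N ⊎ z ∈ P
  ∈-interleave⁻ N       []      z∈                  = inj₁ z∈
  ∈-interleave⁻ []      (p ∷ P) z∈                  = inj₂ z∈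
  ∈-interleave⁻ (x ∷ N) (p ∷ P) (here z≡x)          = inj₁ (here z≡x)
  ∈-interleave⁻ (x ∷ N) (p ∷ P) (there (here z≡p))  = inj₂ (here z≡p)
  ∈-interleave⁻ (x ∷ N) (p ∷ P) (there (there z∈)) with ∈-interleave⁻ N P z∈
  ... | inj₁ z∈N = inj₁ (there z∈N)
  ... | inj₂ z∈P = inj₂ (there z∈P)

  interleave-Unique : ∀ {A : Set} {N P : List A} → Unique N → Unique P → Disjoint N P →
                      Unique (interleave N P)
  interleave-Unique {N = N}     {[]}    N! _ _ = N!
  interleave-Unique {N = []}    {_ ∷ _} _ P! _ = P!
  interleave-Unique {N = x ∷ N} {p ∷ P} (x∉N ∷ N!) (p∉P ∷ P!) disjoint =
    (x≢p ∷ All.tabulate x≢) ∷ All.tabulate p≢ ∷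
    interleave-Unique N! P! (λ (z∈N , z∈P) → disjoint (there z∈N , there z∈P))
    where
    x≢p : x ≢ p
    x≢p x≡p = disjoint (here refl , here x≡p)
    x≢ : ∀ {z} → z ∈ interleave N P → x ≢ z
    x≢ z∈ x≡z with ∈-interleave⁻ N P z∈
    ... | inj₁ z∈N = All.lookup x∉N z∈N x≡z
    ... | inj₂ z∈P = disjoint (here refl , there (subst (_∈ P) (sym x≡z) z∈P))
    p≢ : ∀ {z} → z ∈ interleave N P → p ≢ z
    p≢ z∈ p≡z with ∈-interleave⁻ N P z∈
    ... | inj₁ z∈N = disjoint (there (subst (_∈ N) (sym p≡z) z∈N) , here refl)
    ... | inj₂ z∈P = All.lookup p∉P z∈P p≡z

  length-interleave : ∀ {A : Set} (N P : List A) → length (interleave N P) ≡ length N + length P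
  length-interleave N       []      = sym (+-identityʳ (length N))
  length-interleave []      (p ∷ P) = refl
  length-interleave (x ∷ N) (p ∷ P) =
    cong suc (trans (cong suc (length-interleave N P)) (sym (+-suc (length N) (length P))))

  -- Scanning S ⊆ [n] upwards, a non-peak raises the surplus by one, while a peak needs a
  -- surplus of at least two (its two smaller neighbours) and lowers it by one.
  surplus-step : Maybe ℕ → Bool → Maybe ℕ
  surplus-step nothing              _     = nothing
  surplus-step (just d)             false = just (suc d)
  surplus-step (just (suc (suc d))) true  = just (suc d)
  surplus-step (just _)             true  = nothing

  surplus : ℕ → List Bool → Maybe ℕ
  surplus d = foldl surplus-step (just d)

  admissible : List Bool → Bool
  admissible w = is-just (surplus 0 w)

  countTrue : List Bool → ℕ
  countTrue []          = 0
  countTrue (true ∷ w)  = suc (countTrue w)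
  countTrue (false ∷ w) = countTrue w

  countTrue-∷ʳ-true : ∀ w → countTrue (w ∷ʳ true) ≡ suc (countTrue w)
  countTrue-∷ʳ-true []          = refl
  countTrue-∷ʳ-true (true ∷ w)  = cong suc (countTrue-∷ʳ-true w)
  countTrue-∷ʳ-true (false ∷ w) = countTrue-∷ʳ-true w

  countTrue-∷ʳ-false : ∀ w → countTrue (w ∷ʳ false) ≡ countTrue w
  countTrue-∷ʳ-false []          = refl
  countTrue-∷ʳ-false (true ∷ w)  = cong suc (countTrue-∷ʳ-false w)
  countTrue-∷ʳ-false (false ∷ w) = countTrue-∷ʳ-false w

  length-filterᵇ : ∀ {A : Set} (f : A → Bool) xs → length (filterᵇ f xs) ≡ countTrue (map f xs)
  length-filterᵇ f []       = refl
  length-filterᵇ f (x ∷ xs) with f x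
  ... | true  = cong suc (length-filterᵇ f xs)
  ... | false = length-filterᵇ f xs

  foldl-surplus-step-nothing : ∀ w → foldl surplus-step nothing w ≡ nothing
  foldl-surplus-step-nothing []      = refl
  foldl-surplus-step-nothing (_ ∷ w) = foldl-surplus-step-nothing w

  surplus-∷ʳ : ∀ d w b → surplus d (w ∷ʳ b) ≡ surplus-step (surplus d w) b
  surplus-∷ʳ d w b = foldl-∷ʳ surplus-step (just d) b w

  surplus-balance : ∀ d w {e} → surplus d w ≡ just e → e + 2 * countTrue w ≡ d + length w
  surplus-balance d             []          refl = refl
  surplus-balance d             (false ∷ w) scan =
    trans (surplus-balance (suc d) w scan) (sym (+-suc d (length w)))
  surplus-balance (suc (suc d)) (true ∷ w)  {e} scan =
    trans (shift e (countTrue w)) (trans (cong (2 +_) (surplus-balance (suc d) w scan)) (shift′ d (length w)))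
    where
    shift : ∀ e t → e + 2 * suc t ≡ 2 + (e + 2 * t)
    shift = solve-∀
    shift′ : ∀ d l → 2 + (suc d + l) ≡ suc (suc d) + suc l
    shift′ = solve-∀
  surplus-balance 0 (true ∷ w) scan with () ← trans (sym (foldl-surplus-step-nothing w)) scan
  surplus-balance 1 (true ∷ w) scan with () ← trans (sym (foldl-surplus-step-nothing w)) scan

  surplus-succeeds : ∀ d w → (∀ ys zs → w ≡ ys ++ true ∷ zs → 2 * suc (countTrue ys) ≤ d + length ys) →
                     T (is-just (surplus d w))
  surplus-succeeds d [] _ = _
  surplus-succeeds d (false ∷ w) bound = surplus-succeeds (suc d) w λ ys zs w≡ →
    ≤-trans (bound (false ∷ ys) zs (cong (false ∷_) w≡)) (≤-reflexive (+-suc d (length ys)))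
  surplus-succeeds (suc (suc d)) (true ∷ w) bound = surplus-succeeds (suc d) w λ ys zs w≡ →
    let t = countTrue ys; l = length ys in ≤-pred (≤-pred (begin
      2 + 2 * suc t        ≡⟨ shift t ⟩
      2 * suc (suc t)      ≤⟨ bound (true ∷ ys) zs (cong (true ∷_) w≡) ⟩
      suc (suc d) + suc l  ≡⟨ shift′ d l ⟩
      2 + (suc d + l)      ∎))
    where
    open ≤-Reasoning
    shift : ∀ t → 2 + 2 * suc t ≡ 2 * suc (suc t)
    shift = solve-∀
    shift′ : ∀ d l → suc (suc d) + suc l ≡ 2 + (suc d + l)
    shift′ = solve-∀
  surplus-succeeds 0 (true ∷ w) bound with () ← bound [] w refl
  surplus-succeeds 1 (true ∷ w) bound with s≤s () ← bound [] w refl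

  peakValues-≮ : ∀ {n} {a b : Fin n} r → ¬ a <ᶠ b → peakValues (a ∷ b ∷ r) ≡ peakValues (b ∷ r)
  peakValues-≮             []      _   = refl
  peakValues-≮ {a = a} {b} (c ∷ r) a≮b with a <? b
  ... | yes a<b = contradiction a<b a≮b
  ... | no _    = refl

  peakValues-≯ : ∀ {n} {a b c : Fin n} r → ¬ c <ᶠ b → peakValues (a ∷ b ∷ c ∷ r) ≡ peakValues (b ∷ c ∷ r)
  peakValues-≯ {a = a} {b} {c} r c≮b with a <? b | c <? b
  ... | _     | yes c<b = contradiction c<b c≮b
  ... | yes _ | no _    = refl
  ... | no _  | no _    = refl

  peakValues-peak : ∀ {n} {a b c : Fin n} r → a <ᶠ b → c <ᶠ b →
                    peakValues (a ∷ b ∷ c ∷ r) ≡ b ∷ peakValues (c ∷ r)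
  peakValues-peak {a = a} {b} {c} r a<b c<b with a <? b | c <? b
  ... | yes _  | yes _  = cong (b ∷_) (peakValues-≮ r (<-asym c<b))
  ... | no a≮b | _      = contradiction a<b a≮b
  ... | yes _  | no c≮b = contradiction c<b c≮b

  peakValues-ascending : ∀ {n} {N : List (Fin n)} → AllPairs _<ᶠ_ N → peakValues N ≡ []
  peakValues-ascending []                                             = refl
  peakValues-ascending (_ ∷ [])                                       = refl
  peakValues-ascending (_ ∷ _ ∷ [])                                   = refl
  peakValues-ascending {N = _ ∷ _ ∷ _ ∷ r} (_ ∷ rest@((b<c ∷ _) ∷ _)) =
    trans (peakValues-≯ r (<-asym b<c)) (peakValues-ascending rest)

  IsPerm⇒Unique : ∀ {n} (σ : Vec (Fin n) n) → IsPerm σ → Unique (toList σ)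
  IsPerm⇒Unique σ perm = subst Unique (sym (toList≡tabulate-lookup σ)) (Unique.tabulate⁺ (perm _ _))

  CP-member : ∀ {n} (σ : Vec (Fin n) n) {u} → T (lookup (CP σ) u) → u ∈ peakValues (toList σ)
  CP-member σ {u} u∈CP = toWitness (subst T (lookup∘tabulate _ u) u∈CP)

  -- Necessity: counting low peaks

  module LowValues {n : ℕ} (m : ℕ) where

    Low : Fin n → Set
    Low u = toℕ u < m

    low? : ∀ u → Dec (Low u)
    low? u = toℕ u ℕ.<? m

    lowCount : List (Fin n) → ℕ
    lowCount L = length (filter low? L)

    lowPeakCount : List (Fin n) → ℕ
    lowPeakCount = lowCount ∘ peakValues

    lowCount-low : ∀ {x} L → Low x → lowCount (x ∷ L) ≡ suc (lowCount L)
    lowCount-low L low = cong length (filter-accept low? low)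

    lowCount-high : ∀ {x} L → ¬ Low x → lowCount (x ∷ L) ≡ lowCount L
    lowCount-high L high = cong length (filter-reject low? high)

    lowCount-unique : ∀ {L} → Unique L → lowCount L ≤ m
    lowCount-unique {L} unique = begin
      lowCount L             ≡⟨ length-map toℕ lows ⟨
      length (map toℕ lows)  ≤⟨ Unique-⊆⇒length-≤ (Unique.map⁺ toℕ-injective (Unique.filter⁺ low? unique)) below ⟩
      length (upTo m)        ≡⟨ length-upTo m ⟩
      m                      ∎
      where
      open ≤-Reasoning
      lows = filter low? L
      below : map toℕ lows ⊆ upTo m
      below v∈ with u , u∈ , refl ← ∈-map⁻ toℕ v∈ = ∈-upTo⁺ (proj₂ (∈-filter⁻ low? {xs = L} u∈))

    -- A low peak has low neighbours and peaks are never adjacent, so a maximal run of r low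
    -- entries holds at most (r − 1) / 2 low peaks.
    LowPeakBound : Fin n → List (Fin n) → Set
    LowPeakBound x L = Low x ⊎ 0 < lowPeakCount (x ∷ L) → suc (2 * lowPeakCount (x ∷ L)) ≤ lowCount (x ∷ L)

    lowPeakBound-skip : ∀ x b L → lowPeakCount (x ∷ b ∷ L) ≡ lowPeakCount (b ∷ L) →
                        LowPeakBound b L → LowPeakBound x (b ∷ L)
    lowPeakBound-skip x b L same bound hyp with low? x
    ... | yes low = begin
      suc (2 * lowPeakCount (x ∷ b ∷ L))  ≡⟨ cong (suc ∘ (2 *_)) same ⟩
      suc (2 * lowPeakCount (b ∷ L))      ≤⟨ s≤s (doubled (lowPeakCount (b ∷ L)) (bound ∘ inj₂)) ⟩
      suc (lowCount (b ∷ L))              ≡⟨ lowCount-low (b ∷ L) low ⟨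
      lowCount (x ∷ b ∷ L)                ∎
      where
      open ≤-Reasoning
      doubled : ∀ p → (0 < p → suc (2 * p) ≤ lowCount (b ∷ L)) → 2 * p ≤ lowCount (b ∷ L)
      doubled zero    _ = z≤n
      doubled (suc p) f = <⇒≤ (f (s≤s z≤n))
    ... | no high with hyp
    ...   | inj₁ low      = contradiction low high
    ...   | inj₂ has-peak = subst₂ (λ p c → suc (2 * p) ≤ c) (sym same) (sym (lowCount-high (b ∷ L) high))
                              (bound (inj₂ (subst (0 <_) same has-peak)))

    lowPeakBound-peak : ∀ x b c r → x <ᶠ b → c <ᶠ b → Low b → LowPeakBound c r → LowPeakBound x (b ∷ c ∷ r)
    lowPeakBound-peak x b c r x<b c<b low bound _ = begin
      suc (2 * lowPeakCount (x ∷ b ∷ c ∷ r))  ≡⟨ cong (suc ∘ (2 *_)) peaks ⟩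
      suc (2 * suc (lowPeakCount (c ∷ r)))    ≡⟨ cong suc (*-suc 2 (lowPeakCount (c ∷ r))) ⟩
      2 + suc (2 * lowPeakCount (c ∷ r))      ≤⟨ s≤s (s≤s (bound (inj₁ (<-trans c<b low)))) ⟩
      2 + lowCount (c ∷ r)                    ≡⟨ entries ⟨
      lowCount (x ∷ b ∷ c ∷ r)                ∎
      where
      open ≤-Reasoning
      peaks : lowPeakCount (x ∷ b ∷ c ∷ r) ≡ suc (lowPeakCount (c ∷ r))
      peaks = trans (cong lowCount (peakValues-peak r x<b c<b)) (lowCount-low (peakValues (c ∷ r)) low)
      entries : lowCount (x ∷ b ∷ c ∷ r) ≡ 2 + lowCount (c ∷ r)
      entries = trans (lowCount-low (b ∷ c ∷ r) (<-trans x<b low)) (cong suc (lowCount-low (c ∷ r) low))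

    lowPeakBound-step : ∀ x b c r → Dec (x <ᶠ b) → Dec (c <ᶠ b) → Dec (Low b) →
                        LowPeakBound b (c ∷ r) → LowPeakBound c r → LowPeakBound x (b ∷ c ∷ r)
    lowPeakBound-step x b c r (yes x<b) (yes c<b) (yes low) _ bound =
      lowPeakBound-peak x b c r x<b c<b low bound
    lowPeakBound-step x b c r (yes x<b) (yes c<b) (no high) bound _ =
      lowPeakBound-skip x b (c ∷ r) (trans (cong lowCount (peakValues-peak r x<b c<b))
        (trans (lowCount-high (peakValues (c ∷ r)) high) (cong lowCount (sym (peakValues-≮ r (<-asym c<b))))))
        bound
    lowPeakBound-step x b c r (yes _) (no c≮b) _ bound _ =
      lowPeakBound-skip x b (c ∷ r) (cong lowCount (peakValues-≯ r c≮b)) bound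
    lowPeakBound-step x b c r (no x≮b) _ _ bound _ =
      lowPeakBound-skip x b (c ∷ r) (cong lowCount (peakValues-≮ (c ∷ r) x≮b)) bound

    lowPeakBound : ∀ x L → LowPeakBound x L
    lowPeakBound x []          (inj₁ low) = subst (1 ≤_) (sym (lowCount-low [] low)) (s≤s z≤n)
    lowPeakBound x (b ∷ [])    (inj₁ low) = subst (1 ≤_) (sym (lowCount-low (b ∷ []) low)) (s≤s z≤n)
    lowPeakBound x (b ∷ c ∷ r) =
      lowPeakBound-step x b c r (x <? b) (c <? b) (low? b) (lowPeakBound b (c ∷ r)) (lowPeakBound c r)

    lowPeakBound′ : ∀ L → 0 < lowPeakCount L → suc (2 * lowPeakCount L) ≤ lowCount L
    lowPeakBound′ (x ∷ L) = lowPeakBound x L ∘ inj₂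

  length-members-below : ∀ {n} (S : Vec Bool n) m →
    length (filterᵇ (lookup S) (filter (λ u → toℕ u ℕ.<? m) (allFin n))) ≡ countTrue (take m (toList S))
  length-members-below {n} S m = begin
    length (filterᵇ (lookup S) lows)             ≡⟨ length-filterᵇ (lookup S) lows ⟩
    countTrue (map (lookup S) lows)              ≡⟨ cong (countTrue ∘ map (lookup S)) (filter-below-allFin n m) ⟩
    countTrue (map (lookup S) (take m (allFin n))) ≡⟨ cong countTrue (take-map m (allFin n)) ⟨
    countTrue (take m (map (lookup S) (allFin n))) ≡⟨ cong (countTrue ∘ take m) (map-lookup-allFin S) ⟩
    countTrue (take m (toList S))                ∎
    where
    open ≡-Reasoning
    lows = filter (λ u → toℕ u ℕ.<? m) (allFin n)

  -- Values are 0-based: the peak right after ys is k = length ys, and the low values are those ≤ k.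
  peak-prefix-bound : ∀ {n} (σ : Vec (Fin n) n) → IsPerm σ → ∀ ys zs → toList (CP σ) ≡ ys ++ true ∷ zs →
                      2 * suc (countTrue ys) ≤ length ys
  peak-prefix-bound {n} σ perm ys zs split = ≤-pred (begin
    suc (2 * suc t)           ≤⟨ s≤s (*-monoʳ-≤ 2 enough-peaks) ⟩
    suc (2 * lowPeakCount L)  ≤⟨ lowPeakBound′ L (≤-trans (s≤s z≤n) enough-peaks) ⟩
    lowCount L                ≤⟨ lowCount-unique (IsPerm⇒Unique σ perm) ⟩
    suc k                     ∎)
    where
    open ≤-Reasoning
    t = countTrue ys
    k = length ys
    L = toList σ
    S = CP σ
    open LowValues {n} (suc k)
    low-peaks = filterᵇ (lookup S) (filter low? (allFin n))
    |low-peaks| : length low-peaks ≡ suc t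
    |low-peaks| = begin-equality
      length low-peaks                            ≡⟨ length-members-below S (suc k) ⟩
      countTrue (take (suc k) (toList S))         ≡⟨ cong (countTrue ∘ take (suc k)) split ⟩
      countTrue (take (suc k) (ys ++ true ∷ zs))  ≡⟨ cong countTrue (take-suc-length ys zs) ⟩
      countTrue (ys ∷ʳ true)                      ≡⟨ countTrue-∷ʳ-true ys ⟩
      suc t                                       ∎
    low-peaks⊆ : low-peaks ⊆ filter low? (peakValues L)
    low-peaks⊆ u∈ with u∈lows , peak ← ∈-filter⁻ (T? ∘ lookup S) {xs = filter low? (allFin n)} u∈ =
      ∈-filter⁺ low? (CP-member σ peak) (proj₂ (∈-filter⁻ low? {xs = allFin n} u∈lows))
    enough-peaks : suc t ≤ lowPeakCount L
    enough-peaks = subst (_≤ lowPeakCount L) |low-peaks|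
      (Unique-⊆⇒length-≤ (Unique.filter⁺ _ (Unique.filter⁺ low? (Unique.allFin⁺ n))) low-peaks⊆)

  peakSet⇒admissible : ∀ {n} (S : Vec Bool n) → S ∈𝒫 n → T (admissible (toList S))
  peakSet⇒admissible {n} S S∈𝒫 with σ , σ∈𝔖 , refl ← find S∈𝒫 =
    surplus-succeeds 0 (toList (CP σ))
      (peak-prefix-bound σ (proj₂ (∈-filter⁻ isPerm? {xs = words (allFin n) n} σ∈𝔖)))

  -- Sufficiency: interleaving non-peaks and peaks

  members nonMembers : ∀ {n} → Vec Bool n → List (Fin n)
  members    {n} S = filterᵇ (lookup S) (allFin n)
  nonMembers {n} S = filterᵇ (not ∘ lookup S) (allFin n)

  members-disjoint : ∀ {n} (S : Vec Bool n) → Disjoint (nonMembers S) (members S)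
  members-disjoint {n} S {v} (v∈N , v∈P) =
    not-both (lookup S v) (proj₂ (∈-filter⁻ (T? ∘ (not ∘ lookup S)) {xs = allFin n} v∈N))
                          (proj₂ (∈-filter⁻ (T? ∘ lookup S) {xs = allFin n} v∈P))
    where
    not-both : ∀ b → T (not b) → T b → ⊥
    not-both false _ ()

  any-members : ∀ {n} (S : Vec Bool n) v → ⌊ any? (v ≟ᶠ_) (members S) ⌋ ≡ lookup S v
  any-members {n} S v = T-injective
    (λ v∈P → proj₂ (∈-filter⁻ (T? ∘ lookup S) {xs = allFin n} (toWitness v∈P)))
    (λ v∈S → fromWitness (∈-filter⁺ (T? ∘ lookup S) (∈-allFin v) v∈S))

  -- The i-th peak exceeds the i-th and (i+1)-st entries of N, so interleave N P has peak values P.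
  data Interleavable {n : ℕ} : List (Fin n) → List (Fin n) → Set where
    ascending : ∀ {N} → AllPairs _<ᶠ_ N → Interleavable N []
    peak      : ∀ {a b p N P} → a <ᶠ p → b <ᶠ p → Interleavable (b ∷ N) P → Interleavable (a ∷ b ∷ N) (p ∷ P)

  peakValues-interleave : ∀ {n} {N P : List (Fin n)} → Interleavable N P → peakValues (interleave N P) ≡ P
  peakValues-interleave (ascending N↑) = peakValues-ascending N↑
  peakValues-interleave (peak {p = p} {N} {[]}    a<p b<p rest) =
    trans (peakValues-peak N a<p b<p) (cong (p ∷_) (peakValues-interleave rest))
  peakValues-interleave (peak {p = p} {N} {q ∷ P} a<p b<p rest) =
    trans (peakValues-peak (q ∷ interleave N P) a<p b<p) (cong (p ∷_) (peakValues-interleave rest))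

  -- The pending list A holds the non-peaks not yet placed, and its length is the current surplus.
  interleavable-from-scan : ∀ {n} (S : Vec Bool n) (A ys : List (Fin n)) {e} →
    AllPairs _<ᶠ_ (A ++ ys) → surplus (length A) (map (lookup S) ys) ≡ just e →
    Interleavable (A ++ filterᵇ (not ∘ lookup S) ys) (filterᵇ (lookup S) ys)
  interleavable-from-scan S A [] ↑ _ = ascending ↑
  interleavable-from-scan S A (y ∷ ys) {e} ↑ scan with lookup S y
  ... | false = subst (λ N → Interleavable N (filterᵇ (lookup S) ys)) (∷ʳ-++ A y _)
    (interleavable-from-scan S (A ∷ʳ y) ys (subst (AllPairs _<ᶠ_) (sym (∷ʳ-++ A y ys)) ↑)
      (subst (λ d → surplus d (map (lookup S) ys) ≡ just e) (sym |A∷ʳy|) scan))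
    where
    |A∷ʳy| : length (A ∷ʳ y) ≡ suc (length A)
    |A∷ʳy| = trans (length-++ A) (+-comm (length A) 1)
  interleavable-from-scan S (a₀ ∷ a₁ ∷ A) (y ∷ ys) ↑@(a₀< ∷ a₁< ∷ _) scan | true =
    peak (All.lookup a₀< (∈-++⁺ʳ (a₁ ∷ A) (here refl))) (All.lookup a₁< (∈-++⁺ʳ A (here refl)))
      (interleavable-from-scan S (a₁ ∷ A) ys (AllPairs-++-remove (a₁ ∷ A) (AllPairs.tail ↑)) scan)
  interleavable-from-scan S []       (y ∷ ys) _ scan | true
    with () ← trans (sym (foldl-surplus-step-nothing (map (lookup S) ys))) scan
  interleavable-from-scan S (_ ∷ []) (y ∷ ys) _ scan | true
    with () ← trans (sym (foldl-surplus-step-nothing (map (lookup S) ys))) scan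

  interleavable⇒peakSet : ∀ {n} (S : Vec Bool n) → Interleavable (nonMembers S) (members S) → S ∈𝒫 n
  interleavable⇒peakSet {n} S interleavable = lose (∈-filter⁺ isPerm? (∈-words ∈-allFin σ) σ-perm) CPσ≡S
    where
    L = interleave (nonMembers S) (members S)
    |L| : length L ≡ n
    |L| = trans (length-interleave (nonMembers S) (members S))
            (trans (length-filterᵇ-partition (lookup S) (allFin n)) (length-tabulate (λ i → i)))
    σ : Vec (Fin n) n
    σ = Vec.cast |L| (Vec.fromList L)
    toList-σ : toList σ ≡ L
    toList-σ = trans (toList-cast |L| (Vec.fromList L)) (toList∘fromList L)
    σ-perm : IsPerm σ
    σ-perm = Unique-toList⇒lookup-injective σ (subst Unique (sym toList-σ)
      (interleave-Unique (Unique.filter⁺ _ (Unique.allFin⁺ n)) (Unique.filter⁺ _ (Unique.allFin⁺ n))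
                         (members-disjoint S)))
    peaks : peakValues (toList σ) ≡ members S
    peaks = trans (cong peakValues toList-σ) (peakValues-interleave interleavable)
    CPσ≡S : CP σ ≡ S
    CPσ≡S = trans (tabulate-cong λ v → trans (cong (λ L′ → ⌊ any? (v ≟ᶠ_) L′ ⌋) peaks) (any-members S v))
                  (tabulate∘lookup S)

  admissible⇒peakSet : ∀ {n} (S : Vec Bool n) → T (admissible (toList S)) → S ∈𝒫 n
  admissible⇒peakSet {n} S adm with surplus 0 (toList S) in scan
  ... | just e = interleavable⇒peakSet S (interleavable-from-scan S [] (allFin n) (tabulate⁺-< (λ i<j → i<j))
                   (trans (cong (surplus 0) (map-lookup-allFin S)) scan))

  ∈𝒫?≡admissible : ∀ {n} (S : Vec Bool n) → does (∈𝒫? S) ≡ admissible (toList S)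
  ∈𝒫?≡admissible S with ∈𝒫? S
  ... | yes S∈𝒫 = T-injective (λ _ → peakSet⇒admissible S S∈𝒫) _
  ... | no  S∉𝒫 = T-injective (λ ()) (S∉𝒫 ∘ admissible⇒peakSet S)

module BallotNumbers where

  open PeakSetCharacterisation
    using ( surplus; surplus-∷ʳ; surplus-balance; admissible; countTrue; countTrue-∷ʳ-true
          ; countTrue-∷ʳ-false; ∈𝒫?≡admissible )
  open import Data.Bool using (Bool; true; false; T; _∧_; if_then_else_)
  open import Data.Fin.Subset using (Subset; ∣_∣)
  open import Data.List using (List; []; _∷_; _++_; _∷ʳ_; length; map; filter)
  open import Data.List.Properties using (map-++; map-∘; map-cong; map-cong-local; ++-identityʳ)
  open import Data.List.Relation.Unary.All as All using (All)
  import Data.List.Relation.Unary.All.Properties as All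
  open import Data.Maybe using (just; nothing)
  open import Data.Nat using (ℕ; zero; suc; _+_; _*_; _≤_; _≡ᵇ_; _≟_; z≤n; s≤s)
  open import Data.Nat.Combinatorics using (_C_; nCk≡nC[n∸k]; nC1≡n; nCk+nC[k+1]≡[n+1]C[k+1])
  open import Data.Nat.ListAction using (sum)
  open import Data.Nat.ListAction.Properties using (sum-++)
  open import Data.Nat.Properties
  open import Data.Nat.Tactic.RingSolver using (solve-∀)
  open import Data.Sum using (inj₁; inj₂)
  open import Data.Vec using (toList)
  import Data.Vec as Vec
  open import Data.Vec.Properties using (length-toList)
  open import Function using (_∘_)
  open import Relation.Nullary using (does; contradiction)
  open import Relation.Unary using (Decidable)
  open import Relation.Binary.PropositionalEquality

  indicator : Bool → ℕ
  indicator b = if b then 1 else 0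

  length-filter-filter : ∀ {A : Set} {P Q : A → Set} (P? : Decidable P) (Q? : Decidable Q) xs →
    length (filter Q? (filter P? xs)) ≡ sum (map (λ x → indicator (does (P? x) ∧ does (Q? x))) xs)
  length-filter-filter P? Q? []       = refl
  length-filter-filter P? Q? (x ∷ xs) with does (P? x)
  ... | false = length-filter-filter P? Q? xs
  ... | true with does (Q? x)
  ...   | true  = cong suc (length-filter-filter P? Q? xs)
  ...   | false = length-filter-filter P? Q? xs

  sum-map-++ : ∀ {A : Set} (f : A → ℕ) xs ys → sum (map f (xs ++ ys)) ≡ sum (map f xs) + sum (map f ys)
  sum-map-++ f xs ys = trans (cong sum (map-++ f xs ys)) (sum-++ (map f xs) (map f ys))

  sum-map-+ : ∀ {A : Set} (f g : A → ℕ) xs → sum (map (λ x → f x + g x) xs) ≡ sum (map f xs) + sum (map g xs)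
  sum-map-+ f g []       = refl
  sum-map-+ f g (x ∷ xs) = trans (cong (f x + g x +_) (sum-map-+ f g xs)) (interchange (f x) (g x) _ _)
    where
    interchange : ∀ a b c d → a + b + (c + d) ≡ a + c + (b + d)
    interchange = solve-∀

  boolWords : ℕ → List (List Bool)
  boolWords n = map toList (allSubsets n)

  boolWords-suc : ∀ n → boolWords (suc n) ≡ map (true ∷_) (boolWords n) ++ map (false ∷_) (boolWords n)
  boolWords-suc n = trans (map-++ toList (map (true Vec.∷_) ws) _)
    (cong₂ _++_ (cons true) (trans (cong (map toList) (++-identityʳ (map (false Vec.∷_) ws))) (cons false)))
    where
    ws = allSubsets n
    cons : ∀ b → map toList (map (b Vec.∷_) ws) ≡ map (b ∷_) (map toList ws)
    cons b = trans (sym (map-∘ ws)) (map-∘ ws)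

  boolWords-length : ∀ n → All (λ w → length w ≡ n) (boolWords n)
  boolWords-length n = All.map⁺ (All.universal length-toList (allSubsets n))

  sum-boolWords-cong : ∀ n {f g : List Bool → ℕ} → (∀ w → length w ≡ n → f w ≡ g w) →
                       sum (map f (boolWords n)) ≡ sum (map g (boolWords n))
  sum-boolWords-cong n f≗g = cong sum (map-cong-local (All.map (f≗g _) (boolWords-length n)))

  sum-boolWords-suc : ∀ n (g : List Bool → ℕ) → sum (map g (boolWords (suc n))) ≡
                      sum (map (g ∘ (true ∷_)) (boolWords n)) + sum (map (g ∘ (false ∷_)) (boolWords n))
  sum-boolWords-suc n g = trans (cong (sum ∘ map g) (boolWords-suc n))
    (trans (sum-map-++ g (map (true ∷_) (boolWords n)) (map (false ∷_) (boolWords n)))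
           (cong₂ _+_ (split true) (split false)))
    where
    split : ∀ b → sum (map g (map (b ∷_) (boolWords n))) ≡ sum (map (g ∘ (b ∷_)) (boolWords n))
    split b = cong sum (sym (map-∘ (boolWords n)))

  sum-boolWords-∷ʳ : ∀ n (g : List Bool → ℕ) →
    sum (map g (boolWords (suc n))) ≡ sum (map (λ w → g (w ∷ʳ true) + g (w ∷ʳ false)) (boolWords n))
  sum-boolWords-∷ʳ zero    g = sym (+-assoc (g (true ∷ [])) (g (false ∷ [])) 0)
  sum-boolWords-∷ʳ (suc n) g = begin
    sum (map g (boolWords (suc (suc n))))
      ≡⟨ sum-boolWords-suc (suc n) g ⟩
    sum (map (g ∘ (true ∷_)) (boolWords (suc n))) + sum (map (g ∘ (false ∷_)) (boolWords (suc n)))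
      ≡⟨ cong₂ _+_ (sum-boolWords-∷ʳ n (g ∘ (true ∷_))) (sum-boolWords-∷ʳ n (g ∘ (false ∷_))) ⟩
    sum (map (h ∘ (true ∷_)) (boolWords n)) + sum (map (h ∘ (false ∷_)) (boolWords n))
      ≡⟨ sum-boolWords-suc n h ⟨
    sum (map h (boolWords (suc n)))
      ∎
    where
    open ≡-Reasoning
    h : List Bool → ℕ
    h w = g (w ∷ʳ true) + g (w ∷ʳ false)

  admittedWith : ℕ → List Bool → ℕ
  admittedWith k w = indicator (admissible w ∧ (countTrue w ≡ᵇ k))

  ballot : ℕ → ℕ → ℕ
  ballot n k = sum (map (admittedWith k) (boolWords n))

  ∣S∣≡countTrue : ∀ {n} (S : Subset n) → ∣ S ∣ ≡ countTrue (toList S)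
  ∣S∣≡countTrue Vec.[]            = refl
  ∣S∣≡countTrue (true Vec.∷ S)  = cong suc (∣S∣≡countTrue S)
  ∣S∣≡countTrue (false Vec.∷ S) = ∣S∣≡countTrue S

  cardP≡ballot : ∀ n k → cardP n k ≡ ballot n k
  cardP≡ballot n k = begin
    cardP n k
      ≡⟨ length-filter-filter ∈𝒫? (λ S → ∣ S ∣ ≟ k) (allSubsets n) ⟩
    sum (map (λ S → indicator (does (∈𝒫? S) ∧ (∣ S ∣ ≡ᵇ k))) (allSubsets n))
      ≡⟨ cong sum (map-cong same-indicator (allSubsets n)) ⟩
    sum (map (admittedWith k ∘ toList) (allSubsets n))
      ≡⟨ cong sum (map-∘ (allSubsets n)) ⟩
    ballot n k
      ∎
    where
    open ≡-Reasoning
    same-indicator : ∀ S → indicator (does (∈𝒫? S) ∧ (∣ S ∣ ≡ᵇ k)) ≡ admittedWith k (toList S)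
    same-indicator S = cong₂ (λ a t → indicator (a ∧ (t ≡ᵇ k))) (∈𝒫?≡admissible S) (∣S∣≡countTrue S)

  -- A scanned word with surplus e and k trues has length e + 2k, so appending a peak succeeds
  -- exactly when 2(k + 1) ≤ length.
  countTrue-≢ : ∀ {k e} w → surplus 0 w ≡ just e → e + 2 * k ≢ length w → (countTrue w ≡ᵇ k) ≡ false
  countTrue-≢ {k} {e} w scan ≢ with countTrue w ≡ᵇ k in t≡ᵇk
  ... | false = refl
  ... | true  = contradiction (trans (cong (λ t → e + 2 * t) (sym t≡k)) (surplus-balance 0 w scan)) ≢
    where
    t≡k : countTrue w ≡ k
    t≡k = ≡ᵇ⇒≡ (countTrue w) k (subst T (sym t≡ᵇk) _)

  short-≢ : ∀ {e k n} → e ≤ 1 → 2 * suc k ≤ n → e + 2 * k ≢ n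
  short-≢ {e} {k} e≤1 large refl = 1+n≰n (≤-pred (begin
    2 + 2 * k  ≡⟨ *-suc 2 k ⟨
    2 * suc k  ≤⟨ large ⟩
    e + 2 * k  ≤⟨ +-monoˡ-≤ (2 * k) e≤1 ⟩
    1 + 2 * k  ∎))
    where open ≤-Reasoning

  long-≢ : ∀ {e k n} → n ≤ suc (2 * k) → 2 + e + 2 * k ≢ n
  long-≢ {e} {k} small refl = 1+n≰n (≤-pred (≤-trans (+-monoˡ-≤ (2 * k) (m≤m+n 2 e)) small))

  admittedWith-∷ʳ-false : ∀ k w → admittedWith k (w ∷ʳ false) ≡ admittedWith k w
  admittedWith-∷ʳ-false k w rewrite surplus-∷ʳ 0 w false | countTrue-∷ʳ-false w with surplus 0 w
  ... | nothing = refl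
  ... | just _  = refl

  admittedWith-zero-∷ʳ-true : ∀ w → admittedWith 0 (w ∷ʳ true) ≡ 0
  admittedWith-zero-∷ʳ-true w rewrite surplus-∷ʳ 0 w true | countTrue-∷ʳ-true w with surplus 0 w
  ... | nothing            = refl
  ... | just 0             = refl
  ... | just 1             = refl
  ... | just (suc (suc _)) = refl

  admittedWith-∷ʳ-true-large : ∀ {n k} w → length w ≡ n → 2 * suc k ≤ n →
                               admittedWith (suc k) (w ∷ʳ true) ≡ admittedWith k w
  admittedWith-∷ʳ-true-large {n} {k} w refl large
    rewrite surplus-∷ʳ 0 w true | countTrue-∷ʳ-true w with surplus 0 w in scan
  ... | nothing            = refl
  ... | just 0             = cong indicator (sym (countTrue-≢ {k} w scan (short-≢ {0} {k} z≤n large)))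
  ... | just 1             = cong indicator (sym (countTrue-≢ {k} w scan (short-≢ {1} {k} ≤-refl large)))
  ... | just (suc (suc _)) = refl

  admittedWith-∷ʳ-true-small : ∀ {n k} w → length w ≡ n → n ≤ suc (2 * k) →
                               admittedWith (suc k) (w ∷ʳ true) ≡ 0
  admittedWith-∷ʳ-true-small {n} {k} w refl small
    rewrite surplus-∷ʳ 0 w true | countTrue-∷ʳ-true w with surplus 0 w in scan
  ... | nothing            = refl
  ... | just 0             = refl
  ... | just 1             = refl
  ... | just (suc (suc e)) = cong indicator (countTrue-≢ {k} w scan (long-≢ {e} {k} small))

  ballot-suc : ∀ n k → ballot (suc n) k ≡
               sum (map (λ w → admittedWith k (w ∷ʳ true) + admittedWith k w) (boolWords n))
  ballot-suc n k = trans (sum-boolWords-∷ʳ n (admittedWith k))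
    (cong sum (map-cong (λ w → cong (admittedWith k (w ∷ʳ true) +_) (admittedWith-∷ʳ-false k w)) (boolWords n)))

  ballot-zero : ∀ n → ballot n 0 ≡ 1
  ballot-zero zero    = refl
  ballot-zero (suc n) =
    trans (ballot-suc n 0) (trans (cong sum (map-cong drop-true (boolWords n))) (ballot-zero n))
    where
    drop-true : ∀ w → admittedWith 0 (w ∷ʳ true) + admittedWith 0 w ≡ admittedWith 0 w
    drop-true w = cong (_+ admittedWith 0 w) (admittedWith-zero-∷ʳ-true w)

  ballot-suc-suc-large : ∀ {n k} → 2 * suc k ≤ n → ballot (suc n) (suc k) ≡ ballot n k + ballot n (suc k)
  ballot-suc-suc-large {n} {k} large = trans (ballot-suc n (suc k))
    (trans (sum-boolWords-cong n λ w |w| →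
              cong (_+ admittedWith (suc k) w) (admittedWith-∷ʳ-true-large w |w| large))
           (sum-map-+ (admittedWith k) (admittedWith (suc k)) (boolWords n)))

  ballot-suc-suc-small : ∀ {n k} → n ≤ suc (2 * k) → ballot (suc n) (suc k) ≡ ballot n (suc k)
  ballot-suc-suc-small {n} {k} small = trans (ballot-suc n (suc k))
    (sum-boolWords-cong n λ w |w| → cong (_+ admittedWith (suc k) w) (admittedWith-∷ʳ-true-small w |w| small))

  ballot-vanish : ∀ {n k} → n ≤ 2 * suc k → ballot n (suc k) ≡ 0
  ballot-vanish {zero}      _  = refl
  ballot-vanish {suc n} {k} le = trans (ballot-suc-suc-small (≤-pred (subst (suc n ≤_) (*-suc 2 k) le)))
                                       (ballot-vanish (≤-trans (n≤1+n n) le))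

  C-sym : ∀ k l {n} → k + l ≡ n → n C k ≡ n C l
  C-sym k l refl = trans (nCk≡nC[n∸k] (m≤m+n k l)) (cong ((k + l) C_) (m+n∸m≡n k l))

  absorption : ∀ n k → suc k * (suc n C suc k) ≡ suc n * (n C k)
  absorption zero    zero    = refl
  absorption zero    (suc k) = *-zeroʳ (suc (suc k))
  absorption (suc n) zero    =
    trans (+-identityʳ _) (trans (nC1≡n (suc (suc n))) (sym (*-identityʳ (suc (suc n)))))
  absorption (suc n) (suc k) = begin
    suc (suc k) * (suc (suc n) C suc (suc k))
      ≡⟨ cong (suc (suc k) *_) (nCk+nC[k+1]≡[n+1]C[k+1] (suc n) (suc k)) ⟨
    suc (suc k) * (X + Y)
      ≡⟨ split (suc k) X Y ⟩
    suc k * X + X + suc (suc k) * Y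
      ≡⟨ cong₂ (λ u v → u + X + v) (absorption n k) (absorption n (suc k)) ⟩
    suc n * (n C k) + X + suc n * (n C suc k)
      ≡⟨ regroup (suc n) (n C k) (n C suc k) X ⟩
    suc n * (n C k + n C suc k) + X
      ≡⟨ cong (λ z → suc n * z + X) (nCk+nC[k+1]≡[n+1]C[k+1] n k) ⟩
    suc n * X + X
      ≡⟨ +-comm (suc n * X) X ⟩
    suc (suc n) * X
      ∎
    where
    open ≡-Reasoning
    X = suc n C suc k
    Y = suc n C suc (suc k)
    split : ∀ j X Y → suc j * (X + Y) ≡ j * X + X + suc j * Y
    split = solve-∀
    regroup : ∀ m P Q X → m * P + X + m * Q ≡ m * (P + Q) + X
    regroup = solve-∀

  ballot-one : ∀ N → ballot (suc (suc N)) 1 + 1 ≡ suc N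
  ballot-one zero    = cong (_+ 1) (ballot-vanish {2} {0} ≤-refl)
  ballot-one (suc N) = begin
    ballot (3 + N) 1 + 1                     ≡⟨ cong (_+ 1) (ballot-suc-suc-large {2 + N} {0} (s≤s (s≤s z≤n))) ⟩
    ballot (2 + N) 0 + ballot (2 + N) 1 + 1  ≡⟨ cong (λ b → b + ballot (2 + N) 1 + 1) (ballot-zero (2 + N)) ⟩
    suc (ballot (2 + N) 1 + 1)               ≡⟨ cong suc (ballot-one N) ⟩
    suc (suc N)                              ∎
    where open ≡-Reasoning

  ballot-formula : ∀ N k → suc (2 * k) ≤ N → ballot (suc N) (suc k) + N C k ≡ N C suc k
  ballot-formula (suc N) zero    _  = trans (ballot-one N) (sym (nC1≡n (suc N)))
  ballot-formula (suc N) (suc k) le with m≤n⇒m<n∨m≡n (≤-pred le)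
  ... | inj₁ lt = begin
    ballot (2 + N) (2 + k) + suc N C suc k
      ≡⟨ cong₂ _+_ (ballot-suc-suc-large {suc N} {suc k} (subst (_≤ suc N) (sym (*-suc 2 (suc k))) (s≤s lt)))
                   (sym (nCk+nC[k+1]≡[n+1]C[k+1] N k)) ⟩
    (ballot (suc N) (suc k) + ballot (suc N) (2 + k)) + (N C k + N C suc k)
      ≡⟨ interchange (ballot (suc N) (suc k)) _ (N C k) _ ⟩
    (ballot (suc N) (suc k) + N C k) + (ballot (suc N) (2 + k) + N C suc k)
      ≡⟨ cong₂ _+_ (ballot-formula N k (≤-trans (s≤s (*-monoʳ-≤ 2 (n≤1+n k))) lt)) (ballot-formula N (suc k) lt) ⟩
    N C suc k + N C (2 + k)
      ≡⟨ nCk+nC[k+1]≡[n+1]C[k+1] N (suc k) ⟩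
    suc N C (2 + k)
      ∎
    where
    open ≡-Reasoning
    interchange : ∀ a b c d → a + b + (c + d) ≡ a + c + (b + d)
    interchange = solve-∀
  ... | inj₂ refl = begin
    ballot (2 + N) (2 + k) + suc N C suc k  ≡⟨ cong (_+ suc N C suc k) vanishes ⟩
    suc N C suc k                           ≡⟨ C-sym (suc k) (2 + k) (halves k) ⟩
    suc N C (2 + k)                         ∎
    where
    open ≡-Reasoning
    vanishes : ballot (2 + N) (2 + k) ≡ 0
    vanishes = trans (ballot-suc-suc-small {suc N} {suc k} ≤-refl)
                     (ballot-vanish {suc N} {suc k} (≤-trans (n≤1+n _) (≤-reflexive (sym (*-suc 2 (suc k))))))
    halves : ∀ k → suc k + (2 + k) ≡ suc (2 * suc k)
    halves = solve-∀

  weighted-difference : ∀ c a x y → a + x ≡ y → suc c * x ≡ c * y → suc c * a ≡ y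
  weighted-difference c a x y a+x≡y weights = +-cancelʳ-≡ (suc c * x) (suc c * a) y (begin
    suc c * a + suc c * x  ≡⟨ *-distribˡ-+ (suc c) a x ⟨
    suc c * (a + x)        ≡⟨ cong (suc c *_) a+x≡y ⟩
    y + c * y              ≡⟨ cong (y +_) weights ⟨
    y + suc c * x          ∎)
    where open ≡-Reasoning

  catalan : ∀ m → suc m * ballot (suc (2 * m)) m ≡ (2 * m) C m
  catalan zero    = refl
  catalan (suc j) = begin
    suc (suc j) * ballot (suc (2 * suc j)) (suc j)
      ≡⟨ cong (λ N → suc (suc j) * ballot (suc N) (suc j)) (*-suc 2 j) ⟩
    suc (suc j) * ballot (suc (suc n)) (suc j)
      ≡⟨ weighted-difference (suc j) _ (suc n C j) (suc n C suc j) (ballot-formula (suc n) j (n≤1+n n)) weights ⟩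
    suc n C suc j
      ≡⟨ cong (_C suc j) (*-suc 2 j) ⟨
    (2 * suc j) C suc j
      ∎
    where
    open ≡-Reasoning
    n = suc (2 * j)
    weights : suc (suc j) * (suc n C j) ≡ suc j * (suc n C suc j)
    weights = begin
      suc (suc j) * (suc n C j)        ≡⟨ cong (suc (suc j) *_) (C-sym j (2 + j) (sum₁ j)) ⟩
      suc (suc j) * (suc n C (2 + j))  ≡⟨ absorption n (suc j) ⟩
      suc n * (n C suc j)              ≡⟨ cong (suc n *_) (C-sym j (suc j) (sum₂ j)) ⟨
      suc n * (n C j)                  ≡⟨ absorption n j ⟨
      suc j * (suc n C suc j)          ∎
      where
      sum₁ : ∀ j → j + (2 + j) ≡ 2 + 2 * j
      sum₁ = solve-∀
      sum₂ : ∀ j → j + suc j ≡ suc (2 * j)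
      sum₂ = solve-∀

module EulerCharacteristic where

  open BallotNumbers using (ballot; ballot-zero; ballot-vanish; ballot-suc-suc-large; catalan; cardP≡ballot)
  open import Data.Integer using (ℤ; +_; -_; _+_; _*_)
  open import Data.Integer.Properties
    using (+-identityˡ; +-identityʳ; +-assoc; *-zeroʳ; *-identityʳ; neg-distrib-+; neg-distribˡ-*; pos-+; pos-*)
  open import Data.Integer.Tactic.RingSolver using (solve-∀)
  open import Data.List using (map; upTo; applyUpTo; foldr)
  open import Data.List.Properties using (map-applyUpTo)
  open import Data.Nat as ℕ using (ℕ; zero; suc; _≤_; _∸_; _/_; _%_; NonZero; s≤s)
  open import Data.Nat.Combinatorics using (_C_)
  open import Data.Nat.Divisibility using (m∣m*n)
  open import Data.Nat.DivMod using (m*n/n≡m; +-distrib-/-∣ʳ; m≡m%n+[m/n]*n)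
  import Data.Nat.Properties as ℕ
  open import Data.Product using (∃; _,_)
  open import Data.Rational using () renaming (_/_ to _÷_)
  open import Data.Rational.Properties using (fromℚᵘ-cong)
  open import Data.Rational.Unnormalised using (mkℚᵘ; *≡*)
  open import Function using (_∘_)
  open import Relation.Nullary using (contradiction)
  open import Relation.Binary.PropositionalEquality

  ∑< : ℕ → (ℕ → ℤ) → ℤ
  ∑< zero    f = + 0
  ∑< (suc B) f = ∑< B f + f B

  ∑<-suc : ∀ B f → ∑< (suc B) f ≡ f 0 + ∑< B (f ∘ suc)
  ∑<-suc zero    f = trans (+-identityˡ (f 0)) (sym (+-identityʳ (f 0)))
  ∑<-suc (suc B) f = trans (cong (_+ f (suc B)) (∑<-suc B f)) (+-assoc (f 0) (∑< B (f ∘ suc)) (f (suc B)))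

  ∑<-cong : ∀ B {f g} → (∀ i → f i ≡ g i) → ∑< B f ≡ ∑< B g
  ∑<-cong zero    f≗g = refl
  ∑<-cong (suc B) f≗g = cong₂ _+_ (∑<-cong B f≗g) (f≗g B)

  ∑<-neg : ∀ B f → ∑< B (-_ ∘ f) ≡ - ∑< B f
  ∑<-neg zero    f = refl
  ∑<-neg (suc B) f = trans (cong (_+ - f B) (∑<-neg B f)) (sym (neg-distrib-+ (∑< B f) (f B)))

  foldr-upTo : ∀ B f → foldr _+_ (+ 0) (map f (upTo B)) ≡ ∑< B f
  foldr-upTo zero    f = refl
  foldr-upTo (suc B) f =
    trans (cong (λ x → f 0 + x) (trans (cong (foldr _+_ (+ 0)) shift) (foldr-upTo B (f ∘ suc)))) (sym (∑<-suc B f))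
    where
    shift : map f (applyUpTo suc B) ≡ map (f ∘ suc) (upTo B)
    shift = trans (map-applyUpTo suc f B) (sym (map-applyUpTo (λ i → i) (f ∘ suc) B))

  alternating : ℕ → ℕ → ℤ
  alternating n B = ∑< B (λ i → negOnePow i * + ballot n i)

  χ̃≡-alternating : ∀ n → χ̃ n ≡ - alternating n (suc ((n ∸ 1) / 2))
  χ̃≡-alternating n =
    trans (foldr-upTo B _) (trans (∑<-cong B term) (∑<-neg B (λ i → negOnePow i * + ballot n i)))
    where
    B = suc ((n ∸ 1) / 2)
    term : ∀ i → (- negOnePow i) * + cardP n i ≡ - (negOnePow i * + ballot n i)
    term i = trans (cong (λ c → (- negOnePow i) * + c) (cardP≡ballot n i)) (sym (neg-distribˡ-* (negOnePow i) _))

  -- Pascal's rule for ballot numbers telescopes the alternating sum.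
  alternating-suc : ∀ n B → 2 ℕ.* B ≤ n → alternating (suc n) (suc B) ≡ negOnePow B * + ballot n B
  alternating-suc n zero    _ rewrite ballot-zero (suc n) | ballot-zero n = refl
  alternating-suc n (suc B) 2B+2≤n = begin
    alternating (suc n) (suc B) + - s * + ballot (suc n) (suc B)
      ≡⟨ cong₂ (λ x b → x + - s * b) (alternating-suc n B 2B≤n) pascal ⟩
    s * + ballot n B + - s * (+ ballot n B + + ballot n (suc B))
      ≡⟨ telescope s (+ ballot n B) (+ ballot n (suc B)) ⟩
    - s * + ballot n (suc B)
      ∎
    where
    open ≡-Reasoning
    s = negOnePow B
    2B≤n : 2 ℕ.* B ≤ n
    2B≤n = ℕ.≤-trans (ℕ.*-monoʳ-≤ 2 (ℕ.n≤1+n B)) 2B+2≤n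
    pascal : + ballot (suc n) (suc B) ≡ + ballot n B + + ballot n (suc B)
    pascal = trans (cong +_ (ballot-suc-suc-large {n} {B} 2B+2≤n)) (pos-+ (ballot n B) (ballot n (suc B)))
    telescope : ∀ s a b → s * a + - s * (a + b) ≡ - s * b
    telescope = solve-∀

  2*m/2≡m : ∀ m → (2 ℕ.* m) / 2 ≡ m
  2*m/2≡m m = trans (cong (_/ 2) (ℕ.*-comm 2 m)) (m*n/n≡m m 2)

  [1+2*m]/2≡m : ∀ m → suc (2 ℕ.* m) / 2 ≡ m
  [1+2*m]/2≡m m = trans (+-distrib-/-∣ʳ 1 (m∣m*n {2} m)) (2*m/2≡m m)

  χ̃-odd : ∀ m → χ̃ (suc (2 ℕ.* suc m)) ≡ + 0
  χ̃-odd m = begin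
    χ̃ N                                        ≡⟨ χ̃≡-alternating N ⟩
    - alternating N (suc ((2 ℕ.* suc m) / 2))  ≡⟨ cong (λ B → - alternating N (suc B)) (2*m/2≡m (suc m)) ⟩
    - alternating N (suc (suc m))              ≡⟨ cong -_ (alternating-suc (2 ℕ.* suc m) (suc m) ℕ.≤-refl) ⟩
    - (s * + ballot (2 ℕ.* suc m) (suc m))      ≡⟨ cong (λ b → - (s * + b)) (ballot-vanish {k = m} ℕ.≤-refl) ⟩
    - (s * + 0)                                ≡⟨ cong -_ (*-zeroʳ s) ⟩
    + 0                                        ∎
    where
    open ≡-Reasoning
    N = suc (2 ℕ.* suc m)
    s = negOnePow (suc m)

  χ̃-even : ∀ m → χ̃ (2 ℕ.* suc m) * + (2 ℕ.* suc m) ≡ (+ 2 * negOnePow (suc m)) * + ((2 ℕ.* m) C m)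
  χ̃-even m = begin
    χ̃ (2 ℕ.* suc m) * + (2 ℕ.* suc m)
      ≡⟨ cong₂ _*_ (cong χ̃ (ℕ.*-suc 2 m)) (pos-* 2 (suc m)) ⟩
    χ̃ N * (+ 2 * + suc m)
      ≡⟨ cong (_* (+ 2 * + suc m)) (χ̃≡-alternating N) ⟩
    - alternating N (suc (suc (2 ℕ.* m) / 2)) * (+ 2 * + suc m)
      ≡⟨ cong (λ B → - alternating N (suc B) * (+ 2 * + suc m)) ([1+2*m]/2≡m m) ⟩
    - alternating N (suc m) * (+ 2 * + suc m)
      ≡⟨ cong (λ x → - x * (+ 2 * + suc m)) (alternating-suc (suc (2 ℕ.* m)) m (ℕ.n≤1+n _)) ⟩
    - (negOnePow m * + A) * (+ 2 * + suc m)
      ≡⟨ regroup (negOnePow m) (+ A) (+ suc m) ⟩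
    (+ 2 * negOnePow (suc m)) * (+ suc m * + A)
      ≡⟨ cong ((+ 2 * negOnePow (suc m)) *_) (trans (sym (pos-* (suc m) A)) (cong +_ (catalan m))) ⟩
    (+ 2 * negOnePow (suc m)) * + ((2 ℕ.* m) C m)
      ∎
    where
    open ≡-Reasoning
    N = 2 ℕ.+ 2 ℕ.* m
    A = ballot (suc (2 ℕ.* m)) m
    regroup : ∀ s a c → - (s * a) * (+ 2 * c) ≡ (+ 2 * - s) * (c * a)
    regroup = solve-∀

  ÷-cross : ∀ p q a b → p * + suc b ≡ q * + suc a → p ÷ suc a ≡ q ÷ suc b
  ÷-cross p q a b eq = fromℚᵘ-cong {mkℚᵘ p a} {mkℚᵘ q b} (*≡* eq)

  χ̃-even-ℚ : ∀ n .{{_ : NonZero n}} m → n ≡ 2 ℕ.* suc m →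
             χ̃ n ÷ 1 ≡ ((+ 2 * negOnePow (n / 2)) * + ((n ∸ 2) C ((n ∸ 2) / 2))) ÷ n
  χ̃-even-ℚ .(2 ℕ.* suc m) m refl = begin
    χ̃ n ÷ 1
      ≡⟨ ÷-cross (χ̃ n) (c * + ((2 ℕ.* m) C m)) 0 _ (trans (χ̃-even m) (sym (*-identityʳ _))) ⟩
    (c * + ((2 ℕ.* m) C m)) ÷ n
      ≡⟨ cong (λ k → (c * + ((2 ℕ.* m) C k)) ÷ n) (2*m/2≡m m) ⟨
    (c * + ((2 ℕ.* m) C ((2 ℕ.* m) / 2))) ÷ n
      ≡⟨ cong₂ (λ h k → ((+ 2 * negOnePow h) * + (k C (k / 2))) ÷ n)
               (2*m/2≡m (suc m)) (cong (_∸ 2) (ℕ.*-suc 2 m)) ⟨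
    ((+ 2 * negOnePow (n / 2)) * + ((n ∸ 2) C ((n ∸ 2) / 2))) ÷ n
      ∎
    where
    open ≡-Reasoning
    n = 2 ℕ.* suc m
    c = + 2 * negOnePow (suc m)

  odd≥3-form : ∀ n → 3 ≤ n → n % 2 ≡ 1 → ∃ λ m → n ≡ suc (2 ℕ.* suc m)
  odd≥3-form n 3≤n n%2≡1 with n / 2 | trans (m≡m%n+[m/n]*n n 2) (cong (ℕ._+ n / 2 ℕ.* 2) n%2≡1)
  ... | zero  | refl = contradiction 3≤n λ { (s≤s ()) }
  ... | suc m | n≡   = m , trans n≡ (cong suc (ℕ.*-comm (suc m) 2))

  even≥3-form : ∀ n → 3 ≤ n → n % 2 ≡ 0 → ∃ λ m → n ≡ 2 ℕ.* suc m
  even≥3-form n 3≤n n%2≡0 with n / 2 | trans (m≡m%n+[m/n]*n n 2) (cong (ℕ._+ n / 2 ℕ.* 2) n%2≡0)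
  ... | zero  | refl = contradiction 3≤n λ ()
  ... | suc m | n≡   = m , trans n≡ (ℕ.*-comm (suc m) 2)

open EulerCharacteristic using (χ̃-odd; χ̃-even-ℚ; odd≥3-form; even≥3-form)
open import Data.Nat using (ℕ; _≤_; _∸_; _/_; _%_; NonZero)
open import Data.Nat.Combinatorics using (_C_)
open import Data.Integer using (+_; _*_)
open import Data.Product using (_×_; _,_)
open import Data.Rational using () renaming (_/_ to _÷_)
open import Relation.Binary.PropositionalEquality using (_≡_; sym; subst)

corollary3p4 : (n : ℕ) → .{{_ : NonZero n}} → 3 ≤ n →
    (n % 2 ≡ 1 → χ̃ n ≡ + 0) ×
    (n % 2 ≡ 0 → χ̃ n ÷ 1 ≡ ((+ 2 * negOnePow (n / 2)) * + ((n ∸ 2) C ((n ∸ 2) / 2))) ÷ n)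
corollary3p4 n 3≤n = odd , even
  where
  odd : n % 2 ≡ 1 → χ̃ n ≡ + 0
  odd n%2≡1 = let m , n≡ = odd≥3-form n 3≤n n%2≡1 in subst (λ k → χ̃ k ≡ + 0) (sym n≡) (χ̃-odd m)
  even : n % 2 ≡ 0 → χ̃ n ÷ 1 ≡ ((+ 2 * negOnePow (n / 2)) * + ((n ∸ 2) C ((n ∸ 2) / 2))) ÷ n
  even n%2≡0 = let m , n≡ = even≥3-form n 3≤n n%2≡0 in χ̃-even-ℚ n m n≡
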